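{- Let $X=(S,\mathcal{L})$ and $Y=(T,\mathcal{L}')$ be pairwise balanced designs. A partial function $f:S\to T$ is a morphism if and only if the domain of $f$ is an open subset of $X$ and $f^{ -1}(O)$ is an open set of $X$ for every open set $O$ of $Y$.
   Context: A PBD is a pair $(S,\mathcal{L})$ with $S$ finite and $\mathcal{L}$ a set of subsets (blocks) of size at least 2 such that every pair of distinct points lies in exactly one block. A subsystem is a set $F$ of points such that for all distinct $x,y\in F$ the block containing them is contained in $F$; an open set is the complement of a subsystem. For a partial function $f:S\to T$ with domain $S_0$, $f^{ -1}(B)=\{x\in S_0: f(x)\in B\}$ is the usual inverse image and $f^{ -w}(B)=f^{ -1}(B)\cup(S\setminus S_0)$ is the Wilson inverse image. $f$ is a morphism if $f^{ -w}(F)$ is a subsystem of $X$ for every subsystem $F$ of $Y$. -}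

module Defs where

open import Data.Nat using (ℕ; _≤_)
open import Data.Fin using (Fin)
open import Data.Fin.Subset using (Subset; _∈_; _⊆_; ∣_∣; ∁)
open import Data.Vec using (tabulate; lookup)
open import Data.Maybe using (Maybe; just; nothing)
open import Data.Bool using (Bool; true; false)
open import Data.Product using (Σ; _×_)
open import Relation.Binary.PropositionalEquality using (_≡_; _≢_)

record PBD (n : ℕ) : Set where
  field
    b          : ℕ
    block      : Fin b → Subset n
    block-size : ∀ i → 2 ≤ ∣ block i ∣
    pair-cover : ∀ x y → x ≢ y → Σ (Fin b) λ i → (x ∈ block i × y ∈ block i)
    pair-uniq  : ∀ x y → x ≢ y → ∀ i j →
                 x ∈ block i → y ∈ block i → x ∈ block j → y ∈ block j → i ≡ j
open PBD public

IsSubsystem : ∀ {n} → PBD n → Subset n → Set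
IsSubsystem X F = ∀ x y → x ∈ F → y ∈ F → x ≢ y →
  ∀ i → x ∈ block X i → y ∈ block X i → block X i ⊆ F

IsOpen : ∀ {n} → PBD n → Subset n → Set
IsOpen {n} X O = Σ (Subset n) λ F → IsSubsystem X F × O ≡ ∁ F

PartialFun : ℕ → ℕ → Set
PartialFun m k = Fin m → Maybe (Fin k)

dom : ∀ {m k} → PartialFun m k → Subset m
dom f = tabulate λ x → isJust (f x)
  where
  isJust : ∀ {A : Set} → Maybe A → Bool
  isJust (just _) = true
  isJust nothing  = false

preimage : ∀ {m k} → PartialFun m k → Subset k → Subset m
preimage f B = tabulate λ x → go (f x)
  where
  go : Maybe (Fin _) → Bool
  go (just y) = lookup B y
  go nothing  = false

wpreimage : ∀ {m k} → PartialFun m k → Subset k → Subset m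
wpreimage f B = tabulate λ x → go (f x)
  where
  go : Maybe (Fin _) → Bool
  go (just y) = lookup B y
  go nothing  = true

IsMorphism : ∀ {m k} → PBD m → PBD k → PartialFun m k → Set
IsMorphism X Y f = ∀ F → IsSubsystem Y F → IsSubsystem X (wpreimage f F)

module Submission where

-- Complementation turns the Wilson inverse image into the usual
-- inverse image:  f⁻¹(∁ F) = ∁ (f⁻ʷ(F))  for every subset F of T, and in
-- particular  dom f = ∁ (f⁻ʷ(∅)).  Since a set is open exactly when it is the
-- complement of a subsystem, and complementation is an involution,
-- "f⁻ʷ(F) is a subsystem for every subsystem F" is equivalent to
-- "f⁻¹(O) is open for every open O".
--   (⇒) The empty set is a subsystem of Y, so dom f = ∁ (f⁻ʷ(∅)) is open;
--       an open O = ∁ F has f⁻¹(O) = ∁ (f⁻ʷ(F)), the complement of a subsystem.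
--   (⇐) For a subsystem F, f⁻¹(∁ F) = ∁ (f⁻ʷ(F)) is open; since ∁ is
--       injective, f⁻ʷ(F) is itself a subsystem.

open import Defs
open import Data.Fin using (Fin; zero; suc)
open import Data.Fin.Subset using (Subset; ∁; ⊥; inside; outside)
open import Data.Fin.Subset.Properties using (∉⊥; ∪-∩-booleanAlgebra)
open import Data.Product using (_×_; _,_)
open import Data.Maybe using (just; nothing; maybe)
open import Data.Bool using (not)
open import Data.Vec using (tabulate; lookup)
open import Data.Vec.Properties using (lookup-map; lookup-replicate; tabulate-cong; tabulate∘lookup)
open import Data.Empty using (⊥-elim)
open import Function using (_∘_)
open import Function.Bundles using (_⇔_; mk⇔)
open import Relation.Binary.PropositionalEquality
import Algebra.Lattice.Properties.BooleanAlgebra as BooleanAlgebraProperties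

∁-injective : ∀ {n} {A B : Subset n} → ∁ A ≡ ∁ B → A ≡ B
∁-injective {n} {A} {B} ∁A≡∁B = begin
  A       ≡⟨ sym (¬-involutive A) ⟩
  ∁ (∁ A) ≡⟨ cong ∁ ∁A≡∁B ⟩
  ∁ (∁ B) ≡⟨ ¬-involutive B ⟩
  B       ∎
  where
  open ≡-Reasoning
  open BooleanAlgebraProperties (∪-∩-booleanAlgebra n) using (¬-involutive)

subset-ext : ∀ {n} {A B : Subset n} → (∀ x → lookup A x ≡ lookup B x) → A ≡ B
subset-ext {A = A} {B} same = begin
  A                   ≡⟨ sym (tabulate∘lookup A) ⟩
  tabulate (lookup A) ≡⟨ tabulate-cong same ⟩
  tabulate (lookup B) ≡⟨ tabulate∘lookup B ⟩
  B                   ∎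
  where open ≡-Reasoning

lookup-preimage : ∀ {m k} (f : PartialFun m k) (B : Subset k) (x : Fin m) →
  lookup (preimage f B) x ≡ maybe (lookup B) outside (f x)
lookup-preimage f B zero with f zero
... | just y  = refl
... | nothing = refl
lookup-preimage f B (suc x) = lookup-preimage (f ∘ suc) B x

lookup-dom : ∀ {m k} (f : PartialFun m k) (x : Fin m) →
  lookup (dom f) x ≡ maybe (λ _ → inside) outside (f x)
lookup-dom f zero with f zero
... | just y  = refl
... | nothing = refl
lookup-dom f (suc x) = lookup-dom (f ∘ suc) x

lookup-wpreimage : ∀ {m k} (f : PartialFun m k) (B : Subset k) (x : Fin m) →
  lookup (wpreimage f B) x ≡ maybe (lookup B) inside (f x)
lookup-wpreimage f B zero with f zero
... | just y  = refl
... | nothing = refl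
lookup-wpreimage f B (suc x) = lookup-wpreimage (f ∘ suc) B x

-- The usual inverse image of a complement is the complement of the Wilson
-- inverse image: points outside the domain lie in f⁻ʷ(F) but never in f⁻¹(∁ F).
preimage-∁ : ∀ {m k} (f : PartialFun m k) (F : Subset k) →
             preimage f (∁ F) ≡ ∁ (wpreimage f F)
preimage-∁ f F = subset-ext pointwise
  where
  pointwise : ∀ x → lookup (preimage f (∁ F)) x ≡ lookup (∁ (wpreimage f F)) x
  pointwise x
    rewrite lookup-preimage f (∁ F) x
          | lookup-map x not (wpreimage f F)
          | lookup-wpreimage f F x
    with f x
  ... | just y  = lookup-map y not F
  ... | nothing = refl

dom-as-∁ : ∀ {m k} (f : PartialFun m k) → dom f ≡ ∁ (wpreimage f ⊥)
dom-as-∁ f = subset-ext pointwise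
  where
  pointwise : ∀ x → lookup (dom f) x ≡ lookup (∁ (wpreimage f ⊥)) x
  pointwise x
    rewrite lookup-dom f x
          | lookup-map x not (wpreimage f ⊥)
          | lookup-wpreimage f ⊥ x
    with f x
  ... | just y  = cong not (sym (lookup-replicate y outside))
  ... | nothing = refl

∅-subsystem : ∀ {n} (X : PBD n) → IsSubsystem X ⊥
∅-subsystem X x y x∈⊥ = ⊥-elim (∉⊥ x∈⊥)

∁-open⇒subsystem : ∀ {n} (X : PBD n) (F : Subset n) → IsOpen X (∁ F) → IsSubsystem X F
∁-open⇒subsystem X F (G , G-subsystem , ∁F≡∁G) =
  subst (IsSubsystem X) (∁-injective (sym ∁F≡∁G)) G-subsystem

proposition6p1 : ∀ {m k} (X : PBD m) (Y : PBD k) (f : PartialFun m k) →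
    IsMorphism X Y f ⇔ (IsOpen X (dom f) × (∀ (O : Subset k) → IsOpen Y O → IsOpen X (preimage f O)))
proposition6p1 X Y f = mk⇔ morphism⇒open open⇒morphism
  where
  morphism⇒open : IsMorphism X Y f →
    IsOpen X (dom f) × (∀ O → IsOpen Y O → IsOpen X (preimage f O))
  morphism⇒open morphism =
      (wpreimage f ⊥ , morphism ⊥ (∅-subsystem Y) , dom-as-∁ f)
    , λ { O (F , F-subsystem , refl) → wpreimage f F , morphism F F-subsystem , preimage-∁ f F }

  open⇒morphism : IsOpen X (dom f) × (∀ O → IsOpen Y O → IsOpen X (preimage f O)) →
    IsMorphism X Y f
  open⇒morphism (_ , preimage-open) F F-subsystem =
    ∁-open⇒subsystem X (wpreimage f F)
      (subst (IsOpen X) (preimage-∁ f F) (preimage-open (∁ F) (F , F-subsystem , refl)))
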